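{- Let $n\ge 2$ and $i\ge 0$. A basis element $x^\Lambda\partial_k\in\mathcal{B}$ belongs to $\mathcal{L}_i\cap\mathcal{B}_k$ if and only if (a) $n-k\le \mathrm{WD}(x^\Lambda\partial_k)<r_i$, and (b) $i=\mathrm{lev}_i(x^\Lambda\partial_k)$.
   Context: Let $n\ge 2$ be an integer. A partition is a sequence $\Lambda=(\lambda_t)_{t\ge 1}$ of non-negative integers with finite support; $\mathrm{wt}(\Lambda)=\sum_t t\lambda_t$; $x^\Lambda=\prod_t x_t^{\lambda_t}$ (monomial in commuting indeterminates), $\deg(x^\Lambda)=\sum_t\lambda_t$. $\mathrm{Part}(j)$ is the set of partitions with $\lambda_t=0$ for $t>j$; $\partial_k$ is the formal symbol of partial derivative with respect to $x_k$. Let $\mathcal{B}=\{x^\Lambda\partial_k:1\le k\le n,\ \Lambda\in\mathrm{Part}(k-1)\}$ and $\mathcal{B}_u=\{x^\Lambda\partial_k\in\mathcal{B}:k=u\}$. For an integer $i\ge -1$ let $r_i\in\{1,\dots,n-1\}$ with $i\equiv r_i\pmod{n-1}$ and $h_i=\lfloor (i-1)/(n-1)\rfloor+1$, so $i=(h_i-1)(n-1)+r_i$. For $x^\Lambda\partial_k\in\mathcal{B}$ define $\mathrm{WD}(x^\Lambda\partial_k)=\mathrm{wt}(\Lambda)-\deg(x^\Lambda)+n-k$ and $\mathrm{lev}_i(x^\Lambda\partial_k)=h_i\,\mathrm{WD}(x^\Lambda\partial_k)+\deg(x^\Lambda)-1$. For $i\ge -1$ let $\mathcal{N}_i=\{b\in\mathcal{B}: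 \mathrm{lev}_j(b)\le j \text{ for some integer } j \text{ with } -1\le j\le i\}$, and for $i\ge 0$ let $\mathcal{L}_i=\mathcal{N}_i\setminus\mathcal{N}_{i-1}$. -}

module Defs where

open import Data.Nat as ℕ using (ℕ; zero; suc)
open import Data.Integer as ℤ using (ℤ; +_; -[1+_]; _+_; _-_; _*_; _≤_; _<_)
open import Data.Integer.DivMod using (_/ℕ_; _%ℕ_)
open import Data.Vec using (Vec; []; _∷_; sum)
open import Data.Product using (Σ; _×_; ∃-syntax)
open import Relation.Nullary using (¬_)
open import Relation.Binary.PropositionalEquality using (_≡_)

-- A partition Λ ∈ Part(k-1) is represented by the vector (λ_1, …, λ_{k-1});
-- all λ_t with t > k-1 are zero.
record Basis (n : ℕ) : Set where
  constructor mkBasis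
  field
    k   : ℕ
    1≤k : 1 ℕ.≤ k
    k≤n : k ℕ.≤ n
    Λ   : Vec ℕ (k ℕ.∸ 1)

wtFrom : ∀ {m} → ℕ → Vec ℕ m → ℕ
wtFrom t []       = 0
wtFrom t (x ∷ xs) = t ℕ.* x ℕ.+ wtFrom (suc t) xs

wt : ∀ {m} → Vec ℕ m → ℕ
wt = wtFrom 1

deg : ∀ {m} → Vec ℕ m → ℕ
deg = sum

-- r_i ∈ {1,…,n-1}, i ≡ r_i (mod n-1), i.e. r_i = ((i-1) mod (n-1)) + 1
-- h_i = ⌊(i-1)/(n-1)⌋ + 1   (floor division; _/ℕ_ is Euclidean = floor for positive divisor)
-- Only meaningful for n ≥ 2 (divisor n-1 = suc m); junk value 0 otherwise.
r : ℕ → ℤ → ℤ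
r (suc (suc m)) i = + ((i - + 1) %ℕ suc m) + + 1
r _             i = + 0

h : ℕ → ℤ → ℤ
h (suc (suc m)) i = ((i - + 1) /ℕ suc m) + + 1
h _             i = + 0

WD : ∀ {n} → Basis n → ℤ
WD {n} b = + wt (Basis.Λ b) - + deg (Basis.Λ b) + + n - + Basis.k b

lev : ∀ {n} → ℤ → Basis n → ℤ
lev {n} i b = h n i * WD b + + deg (Basis.Λ b) - + 1

InN : ∀ {n} → ℤ → Basis n → Set
InN i b = ∃[ j ] (-[1+ 0 ] ≤ j × j ≤ i × lev j b ≤ j)

InL : ∀ {n} → ℕ → Basis n → Set
InL i b = InN (+ i) b × ¬ InN (+ i - + 1) b

InB : ∀ {n} → ℕ → Basis n → Set
InB u b = Basis.k b ≡ u

-- Write W = WD(b) ≥ 0 and j = (h_j - 1)(n - 1) + r_j.  As lev_j = h_j W + deg - 1 is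
-- monotone in j, b enters 𝓝 at i exactly when lev_i = i and lev_j > j for all -1 ≤ j < i.
-- Going back one block lowers j by n - 1 but lev_j only by W, so the earlier positions
-- stay below their levels iff the last position i - r_i of the previous block does,
-- i.e. iff W < r_i.  For i = 0 that position is out of range, but lev_0 = 0 forces
-- deg = 1 and then W ≤ n - 2 < r_0.  The bound n - k ≤ W is just wt ≥ deg.

module Submission where

open import Defs
open import Data.Nat as ℕ using (ℕ; zero; suc; _∸_; z≤n; s≤s)
import Data.Nat.Properties as ℕ
open import Data.Integer as ℤ using (ℤ; +_; 0ℤ; _+_; _-_; _*_; -_; pred; _≤_; _<_; +≤+; -≤+; nonNegative)
open import Data.Integer.Properties
open import Algebra.Bundles using (AbelianGroup)
open import Algebra.Properties.Group (AbelianGroup.group +-0-abelianGroup) using () renaming (∙-cancelˡ to +-cancelˡ-≡)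
open import Data.Integer.DivMod using (a≡a%ℕn+[a/ℕn]*n; n%ℕd<d)
open import Data.Integer.Tactic.RingSolver using (solve-∀)
open import Data.Vec using (Vec; []; _∷_)
open import Data.Product using (_×_; _,_; proj₁; proj₂)
open import Function using (_∘_)
open import Function.Bundles using (_⇔_; mk⇔; module Equivalence)
open import Relation.Nullary using (¬_; contradiction)
open import Relation.Binary.Definitions using (tri<; tri≈; tri>)
open import Relation.Binary.PropositionalEquality using (_≡_; refl; sym; trans; cong; subst; subst₂; module ≡-Reasoning)

pred[i]<j⇒i≤j : ∀ {i j} → pred i < j → i ≤ j
pred[i]<j⇒i≤j {i} pred[i]<j = subst (_≤ _) (suc-pred i) (i<j⇒suc[i]≤j pred[i]<j)

deg≤wtFrom : ∀ {m} t (xs : Vec ℕ m) → deg xs ℕ.≤ wtFrom (suc t) xs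
deg≤wtFrom t []       = z≤n
deg≤wtFrom t (x ∷ xs) = ℕ.+-mono-≤ (ℕ.m≤n*m x (suc t)) (deg≤wtFrom (suc t) xs)

wtFrom≤[t+m]*deg : ∀ {m} t (xs : Vec ℕ m) → wtFrom (suc t) xs ℕ.≤ (t ℕ.+ m) ℕ.* deg xs
wtFrom≤[t+m]*deg t [] = z≤n
wtFrom≤[t+m]*deg {suc m} t (x ∷ xs) = begin
  suc t ℕ.* x ℕ.+ wtFrom (suc (suc t)) xs
    ≤⟨ ℕ.+-mono-≤ (ℕ.*-monoˡ-≤ x 1+t≤t+1+m) (wtFrom≤[t+m]*deg (suc t) xs) ⟩
  (t ℕ.+ suc m) ℕ.* x ℕ.+ (suc t ℕ.+ m) ℕ.* deg xs
    ≡⟨ cong (λ c → (t ℕ.+ suc m) ℕ.* x ℕ.+ c ℕ.* deg xs) (sym (ℕ.+-suc t m)) ⟩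
  (t ℕ.+ suc m) ℕ.* x ℕ.+ (t ℕ.+ suc m) ℕ.* deg xs
    ≡⟨ sym (ℕ.*-distribˡ-+ (t ℕ.+ suc m) x (deg xs)) ⟩
  (t ℕ.+ suc m) ℕ.* (x ℕ.+ deg xs) ∎
  where
  open ℕ.≤-Reasoning
  1+t≤t+1+m : suc t ℕ.≤ t ℕ.+ suc m
  1+t≤t+1+m = ℕ.≤-trans (ℕ.m≤m+n (suc t) m) (ℕ.≤-reflexive (sym (ℕ.+-suc t m)))

n-k≤WD : ∀ {n} (b : Basis n) → + n - + Basis.k b ≤ WD b
n-k≤WD {n} (mkBasis k _ _ Λ) = begin
  + n - + k                     ≡⟨ pad (+ n) (+ k) ⟩
  0ℤ + + n - + k
    ≤⟨ +-monoˡ-≤ (- + k) (+-monoˡ-≤ (+ n) (i≤j⇒0≤j-i (+≤+ (deg≤wtFrom 0 Λ)))) ⟩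
  + wt Λ - + deg Λ + + n - + k  ∎
  where
  open ≤-Reasoning
  pad : ∀ a b → a - b ≡ 0ℤ + a - b
  pad = solve-∀

0≤WD : ∀ {n} (b : Basis n) → 0ℤ ≤ WD b
0≤WD b = ≤-trans (i≤j⇒0≤j-i (+≤+ (Basis.k≤n b))) (n-k≤WD b)

deg≡1⇒WD<n-1 : ∀ {n} (b : Basis n) → deg (Basis.Λ b) ≡ 1 → WD b < + n - + 1
deg≡1⇒WD<n-1 {n} (mkBasis k 1≤k _ Λ) deg≡1 = i≤pred[j]⇒i<j (begin
  + wt Λ - + deg Λ + + n - + k             ≡⟨ cong (λ d → + wt Λ - + d + + n - + k) deg≡1 ⟩
  + wt Λ - + 1 + + n - + k                 ≡⟨ regroup (+ wt Λ) (+ n) (+ k) ⟩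
  (+ wt Λ + + 1 - + k) + (+ n - + 1) - + 1
    ≤⟨ +-monoˡ-≤ (- + 1) (+-monoˡ-≤ (+ n - + 1) (i≤j⇒i-j≤0 (+≤+ wt+1≤k))) ⟩
  0ℤ + (+ n - + 1) - + 1                   ≡⟨ unpad (+ n - + 1) ⟩
  pred (+ n - + 1)                         ∎)
  where
  open ≤-Reasoning
  regroup : ∀ w n k → w - + 1 + n - k ≡ (w + + 1 - k) + (n - + 1) - + 1
  regroup = solve-∀
  unpad : ∀ a → 0ℤ + a - + 1 ≡ ℤ.-1ℤ + a
  unpad = solve-∀
  wt≤k-1 : wt Λ ℕ.≤ k ∸ 1
  wt≤k-1 = subst (wt Λ ℕ.≤_) (trans (cong ((k ∸ 1) ℕ.*_) deg≡1) (ℕ.*-identityʳ (k ∸ 1)))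
                 (wtFrom≤[t+m]*deg 0 Λ)
  wt+1≤k : wt Λ ℕ.+ 1 ℕ.≤ k
  wt+1≤k = ℕ.≤-trans (ℕ.+-monoˡ-≤ 1 wt≤k-1) (ℕ.≤-reflexive (ℕ.m∸n+n≡m 1≤k))

module Blocks (m : ℕ) where

  private
    n = suc (suc m)
    N = + suc m

  1≤r : ∀ i → + 1 ≤ r n i
  1≤r i = +≤+ (ℕ.m≤n+m 1 _)

  r≤n-1 : ∀ i → r n i ≤ N
  r≤n-1 i = +≤+ (ℕ.≤-trans (ℕ.≤-reflexive (ℕ.+-comm _ 1)) (n%ℕd<d (i - + 1) (suc m)))

  i≡[h-1]*[n-1]+r : ∀ i → i ≡ (h n i - + 1) * N + r n i
  i≡[h-1]*[n-1]+r i = begin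
    i                              ≡⟨ shift i ⟩
    (i - + 1) + + 1                ≡⟨ cong (_+ + 1) (a≡a%ℕn+[a/ℕn]*n (i - + 1) (suc m)) ⟩
    (+ s + q * N) + + 1            ≡⟨ regroup (+ s) q N ⟩
    (q + + 1 - + 1) * N + (+ s + + 1) ∎
    where
    open ≡-Reasoning
    q = (i - + 1) ℤ./ℕ suc m
    s = (i - + 1) ℤ.%ℕ suc m
    shift : ∀ i → i ≡ (i - + 1) + + 1
    shift = solve-∀
    regroup : ∀ s q N → (s + q * N) + + 1 ≡ (q + + 1 - + 1) * N + (s + + 1)
    regroup = solve-∀

  block-≤ : ∀ {q q′ s s′} → + 1 ≤ s → s′ ≤ N →
            (q - + 1) * N + s ≤ (q′ - + 1) * N + s′ → q ≤ q′
  block-≤ {q} {q′} {s} {s′} 1≤s s′≤N le = ≮⇒≥ λ q′<q → <⇒≱ (later q′<q) le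
    where
    open ≤-Reasoning
    later : q′ < q → (q′ - + 1) * N + s′ < (q - + 1) * N + s
    later q′<q = begin-strict
      (q′ - + 1) * N + s′   ≤⟨ +-monoʳ-≤ ((q′ - + 1) * N) s′≤N ⟩
      (q′ - + 1) * N + N    ≡⟨ step q′ N ⟩
      q′ * N                ≤⟨ *-monoʳ-≤-nonNeg N (i<j⇒i≤pred[j] q′<q) ⟩
      pred q * N            ≡⟨ rebase q N ⟩
      (q - + 1) * N + 0ℤ    <⟨ +-monoʳ-< ((q - + 1) * N) (suc[i]≤j⇒i<j 1≤s) ⟩
      (q - + 1) * N + s     ∎
      where
      step : ∀ q N → (q - + 1) * N + N ≡ q * N
      step = solve-∀
      rebase : ∀ q N → (ℤ.-1ℤ + q) * N ≡ (q - + 1) * N + 0ℤ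
      rebase = solve-∀

  h-mono-≤ : ∀ {i j} → j ≤ i → h n j ≤ h n i
  h-mono-≤ {i} {j} j≤i =
    block-≤ (1≤r j) (r≤n-1 i) (subst₂ _≤_ (i≡[h-1]*[n-1]+r j) (i≡[h-1]*[n-1]+r i) j≤i)

  h-r-unique : ∀ {i q s} → + 1 ≤ s → s ≤ N → i ≡ (q - + 1) * N + s → h n i ≡ q × r n i ≡ s
  h-r-unique {i} {q} {s} 1≤s s≤N i≡ = h≡q , +-cancelˡ-≡ ((q - + 1) * N) (r n i) s r-eq
    where
    decomp : (h n i - + 1) * N + r n i ≡ (q - + 1) * N + s
    decomp = trans (sym (i≡[h-1]*[n-1]+r i)) i≡
    h≡q : h n i ≡ q
    h≡q = ≤-antisym (block-≤ (1≤r i) s≤N (≤-reflexive decomp))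
                    (block-≤ 1≤s (r≤n-1 i) (≤-reflexive (sym decomp)))
    r-eq : (q - + 1) * N + r n i ≡ (q - + 1) * N + s
    r-eq = trans (cong (λ c → (c - + 1) * N + r n i) (sym h≡q)) decomp

  h-r-at-0 : h n 0ℤ ≡ 0ℤ × r n 0ℤ ≡ N
  h-r-at-0 = h-r-unique {q = 0ℤ} (+≤+ (s≤s z≤n)) ≤-refl (0≡last N)
    where
    0≡last : ∀ N → 0ℤ ≡ (0ℤ - + 1) * N + N
    0≡last = solve-∀

module Levels (m : ℕ) (b : Basis (suc (suc m))) where

  open Blocks m

  private
    n = suc (suc m)
    N = + suc m
    W = WD b
    D = + deg (Basis.Λ b)

  lev-mono-≤ : ∀ {i j} → j ≤ i → lev j b ≤ lev i b
  lev-mono-≤ j≤i =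
    +-monoˡ-≤ (- + 1) (+-monoˡ-≤ D (*-monoʳ-≤-nonNeg W {{nonNegative (0≤WD b)}} (h-mono-≤ j≤i)))

  lev-by-blocks : ∀ {i j} → i ≡ lev i b →
                  lev j b ≡ j + ((h n i - h n j) * (N - W) + (r n i - r n j))
  lev-by-blocks {i} {j} i≡lev = begin
    lev j b                                                  ≡⟨ shift (h n j) (h n i) W D ⟩
    lev i b + (h n j - h n i) * W                            ≡⟨ cong (_+ (h n j - h n i) * W) (sym i≡lev) ⟩
    i + (h n j - h n i) * W                                  ≡⟨ cong (_+ (h n j - h n i) * W) (i≡[h-1]*[n-1]+r i) ⟩
    ((h n i - + 1) * N + r n i) + (h n j - h n i) * W        ≡⟨ regroup (h n i) (h n j) (r n i) (r n j) N W ⟩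
    ((h n j - + 1) * N + r n j) + (H * (N - W) + R)          ≡⟨ cong (_+ (H * (N - W) + R)) (sym (i≡[h-1]*[n-1]+r j)) ⟩
    j + (H * (N - W) + R)                                    ∎
    where
    open ≡-Reasoning
    H = h n i - h n j
    R = r n i - r n j
    shift : ∀ hj hi W D → hj * W + D - + 1 ≡ (hi * W + D - + 1) + (hj - hi) * W
    shift = solve-∀
    regroup : ∀ hi hj ri rj N W →
              ((hi - + 1) * N + ri) + (hj - hi) * W ≡ ((hj - + 1) * N + rj) + ((hi - hj) * (N - W) + (ri - rj))
    regroup = solve-∀

  -- Each block further back lowers the position by n - 1 but the level only by W,
  -- and W < r n i makes up for the partial block.
  WD<r⇒j<lev[j] : ∀ {i j} → W < r n i → i ≡ lev i b → j < i → j < lev j b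
  WD<r⇒j<lev[j] {i} {j} W<ri i≡lev j<i with <-cmp (h n j) (h n i)
  ... | tri> _ _ hi<hj = contradiction (h-mono-≤ (<⇒≤ j<i)) (<⇒≱ hi<hj)
  ... | tri≈ _ hj≡hi _ = <-≤-trans j<i (≤-reflexive (trans i≡lev (cong (λ q → q * W + D - + 1) (sym hj≡hi))))
  ... | tri< hj<hi _ _ = begin-strict
    j                                                ≡⟨ add-sub j W ⟩
    j + W - W                                        <⟨ +-monoˡ-< (- W) (+-monoʳ-< j W<ri) ⟩
    j + r n i - W                                    ≡⟨ regroup j (r n i) N W ⟩
    j + (+ 1 * (N - W) + (r n i - N))
      ≤⟨ +-monoʳ-≤ j (+-mono-≤ one-block-back (+-monoʳ-≤ (r n i) (neg-mono-≤ (r≤n-1 j)))) ⟩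
    j + ((h n i - h n j) * (N - W) + (r n i - r n j)) ≡⟨ sym (lev-by-blocks {j = j} i≡lev) ⟩
    lev j b                                          ∎
    where
    open ≤-Reasoning
    add-sub : ∀ j W → j ≡ j + W - W
    add-sub = solve-∀
    regroup : ∀ j r N W → j + r - W ≡ j + (+ 1 * (N - W) + (r - N))
    regroup = solve-∀
    1+x-y : ∀ x y → + 1 + (x - (+ 1 + y)) ≡ x - y
    1+x-y = solve-∀
    1≤hi-hj : + 1 ≤ h n i - h n j
    1≤hi-hj = subst (+ 1 ≤_) (1+x-y (h n i) (h n j)) (+-monoʳ-≤ (+ 1) (i≤j⇒0≤j-i (i<j⇒suc[i]≤j hj<hi)))
    one-block-back : + 1 * (N - W) ≤ (h n i - h n j) * (N - W)
    one-block-back =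
      *-monoʳ-≤-nonNeg (N - W) {{nonNegative (i≤j⇒0≤j-i (<⇒≤ (<-≤-trans W<ri (r≤n-1 i))))}} 1≤hi-hj

  WD<r⇒¬InN[i-1] : ∀ {i} → W < r n (+ i) → + i ≡ lev (+ i) b → ¬ InN (+ i - + 1) b
  WD<r⇒¬InN[i-1] W<r i≡lev (j , _ , j≤i-1 , levj≤j) =
    <⇒≱ (WD<r⇒j<lev[j] W<r i≡lev (i≤pred[j]⇒i<j j≤i-1)) levj≤j

  InL⇒i≡lev : ∀ {i} → InN (+ i) b → ¬ InN (+ i - + 1) b → + i ≡ lev (+ i) b
  InL⇒i≡lev {i} (j , -1≤j , j≤i , levj≤j) ∉N = ≤-antisym i≤lev lev≤i
    where
    j≡i : j ≡ + i
    j≡i = ≤-antisym j≤i (pred[i]<j⇒i≤j (≰⇒> λ j≤i-1 → ∉N (j , -1≤j , j≤i-1 , levj≤j)))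
    lev≤i : lev (+ i) b ≤ + i
    lev≤i = subst (λ t → lev t b ≤ t) j≡i levj≤j
    i≤lev : + i ≤ lev (+ i) b
    i≤lev = ≤-trans (pred[i]<j⇒i≤j (≰⇒> λ lev≤i-1 → ∉N (+ i - + 1 , -[1+m]≤n⊖m+1 0 i , ≤-refl , lev≤i-1)))
                    (lev-mono-≤ (i-j≤i (+ i) (+ 1)))

  -- The witness i - r n i is the last position of the block before that of i.
  r≤WD⇒InN[i-1] : ∀ {i} → + 1 ≤ i → i ≡ lev i b → r n i ≤ W → InN (i - + 1) b
  r≤WD⇒InN[i-1] {i} 1≤i i≡lev ri≤W = j , ≤-trans -≤+ 0≤j , +-monoʳ-≤ i (neg-mono-≤ (1≤r i)) , levj≤j
    where
    open ≤-Reasoning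
    j = i - r n i
    j≡ : j ≡ (h n i - + 1) * N
    j≡ = trans (cong (_- r n i) (i≡[h-1]*[n-1]+r i)) (cancel ((h n i - + 1) * N) (r n i))
      where
      cancel : ∀ a b → a + b - b ≡ a
      cancel = solve-∀
    hj≡ : h n j ≡ h n i - + 1
    hj≡ = proj₁ (h-r-unique (+≤+ (s≤s z≤n)) ≤-refl (trans j≡ (last-of-block (h n i) N)))
      where
      last-of-block : ∀ q N → (q - + 1) * N ≡ (q - + 1 - + 1) * N + N
      last-of-block = solve-∀
    0≤j : 0ℤ ≤ j
    0≤j = ≤-trans (*-monoʳ-≤-nonNeg N (i≤j⇒0≤j-i (h-mono-≤ 1≤i))) (≤-reflexive (sym j≡))
    levj≤j : lev j b ≤ j
    levj≤j = begin
      lev j b                     ≡⟨ cong (λ q → q * W + D - + 1) hj≡ ⟩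
      (h n i - + 1) * W + D - + 1 ≡⟨ lower (h n i) W D ⟩
      lev i b - W                 ≡⟨ cong (_- W) (sym i≡lev) ⟩
      i - W                       ≤⟨ +-monoʳ-≤ i (neg-mono-≤ ri≤W) ⟩
      j                           ∎
      where
      lower : ∀ q W D → (q - + 1) * W + D - + 1 ≡ q * W + D - + 1 - W
      lower = solve-∀

  lev0≡0⇒deg≡1 : 0ℤ ≡ lev 0ℤ b → deg (Basis.Λ b) ≡ 1
  lev0≡0⇒deg≡1 0≡lev =
    +-injective (i-j≡0⇒i≡j D (+ 1) (sym (trans 0≡lev (cong (λ q → q * W + D - + 1) (proj₁ h-r-at-0)))))

  InL⇒WD<r : ∀ i → + i ≡ lev (+ i) b → ¬ InN (+ i - + 1) b → W < r n (+ i)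
  InL⇒WD<r zero    0≡lev _  = subst (W <_) (sym (proj₂ h-r-at-0)) (deg≡1⇒WD<n-1 b (lev0≡0⇒deg≡1 0≡lev))
  InL⇒WD<r (suc i) i≡lev ∉N = ≰⇒> (∉N ∘ r≤WD⇒InN[i-1] (+≤+ (s≤s z≤n)) i≡lev)

  InL⇔WD<r×i≡lev : ∀ i → InL i b ⇔ (W < r n (+ i) × + i ≡ lev (+ i) b)
  InL⇔WD<r×i≡lev i = mk⇔
    (λ (∈N , ∉N) → let i≡lev = InL⇒i≡lev ∈N ∉N in InL⇒WD<r i i≡lev ∉N , i≡lev)
    (λ (W<r , i≡lev) → (+ i , -≤+ , ≤-refl , ≤-reflexive (sym i≡lev)) , WD<r⇒¬InN[i-1] W<r i≡lev)

theorem2p15 : (n : ℕ) → 2 ℕ.≤ n → (i : ℕ) →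
    (k : ℕ) (1≤k : 1 ℕ.≤ k) (k≤n : k ℕ.≤ n) (Λ : Vec ℕ (k ∸ 1)) →
    (InL i (mkBasis k 1≤k k≤n Λ) × InB k (mkBasis k 1≤k k≤n Λ))
      ⇔ (((+ n - + k ≤ WD (mkBasis k 1≤k k≤n Λ)) × (WD (mkBasis k 1≤k k≤n Λ) < r n (+ i)))
         × (+ i ≡ lev (+ i) (mkBasis k 1≤k k≤n Λ)))
theorem2p15 (suc zero) (s≤s ())
theorem2p15 (suc (suc m)) _ i k 1≤k k≤n Λ = mk⇔
  (λ (∈L , _) → let (W<r , i≡lev) = to ∈L in (n-k≤WD b , W<r) , i≡lev)
  (λ ((_ , W<r) , i≡lev) → from (W<r , i≡lev) , refl)
  where
  b = mkBasis k 1≤k k≤n Λ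
  open Equivalence (Levels.InL⇔WD<r×i≡lev m b i)
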